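{- Let $\mathcal{A}$ be an $\alpha$-approximation algorithm for TSP, let $G=(V,E,\ell)$ be a weighted graph, $\Phi=(I,T,\mathcal{C})$ an interface of $G$, and $J$ a $T$-join in $G$. Consider the procedure that applies $\mathcal{A}$ in each connected component of $G$ to obtain a TSP tour of that component, lets $Q$ be the (multi-)union of these tours, and returns $F=Q\,\dot\cup\,J$. Then the returned set $F$ is a $\Phi$-tour if and only if $G$ admits a $\Phi$-tour.
   Context: A weighted graph $G=(V,E,\ell)$ is an undirected graph without loops or parallel edges with $\ell:E\to\mathbb{R}_{\ge0}$. Multi-sets of edges are allowed (written $F\subseteq E$), $\dot\cup$ denotes multi-union; $\mathrm{odd}(F)$ is the set of vertices of odd degree in $(V,F)$; a $T$-join is a multi-set $F$ with $\mathrm{odd}(F)=T$. $G/I$ is $G$ with $I$ contracted ($G/\emptyset=G$). TSP on a (connected) weighted graph: find a multi-set $F$ of edges with $(V,F)$ connected and $\mathrm{odd}(F)=\emptyset$ of minimum length; an $\alpha$-approximation algorithm returns such a tour of length at most $\alpha$ times optimum. An interface of $G$ is $\Phi=(I,T,\mathcal{C})$ with $T\subseteq I\subseteq V$, $|T|$ even, $\mathcal{C}$ a partition of $I$. A $\Phi$-tour is a multi-set $F\subseteq E$ with $\mathrm{odd}(F)=T$, $(V,F)/I$ connected, and each $C\in\mathcal{C}$ inside one connected component of $(V,F)$.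
   Formalization: The edge lengths $\ell$ take nonnegative rational values instead of nonnegative reals, and the approximation ratio $\alpha$ is rational. -}

module Defs where

open import Data.Nat as ℕ using (ℕ; zero; suc; _%_)
open import Data.Fin using (Fin; zero; suc)
open import Data.Fin.Properties using (_≟_)
open import Data.Fin.Subset using (Subset; _∈_; _⊆_; ∣_∣; Nonempty)
open import Data.Rational as ℚ using (ℚ; 0ℚ)
import Data.Integer
open import Data.Product using (Σ; ∃; _×_; _,_; proj₁; proj₂)
open import Data.Sum using (_⊎_)
open import Relation.Binary.PropositionalEquality using (_≡_; _≢_)
open import Relation.Nullary using (¬_; does)
open import Data.Bool using (if_then_else_)
open import Function.Bundles using (_⇔_)

record WGraph (n : ℕ) : Set where
  field
    m        : ℕ
    ends     : Fin m → Fin n × Fin n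
    ℓ        : Fin m → ℚ
  Joins : Fin m → Fin n → Fin n → Set
  Joins e u w = ends e ≡ (u , w) ⊎ ends e ≡ (w , u)
  field
    loopless   : ∀ e → proj₁ (ends e) ≢ proj₂ (ends e)
    noParallel : ∀ e e' → Joins e' (proj₁ (ends e)) (proj₂ (ends e)) → e ≡ e'
    ℓ≥0        : ∀ e → 0ℚ ℚ.≤ ℓ e

open WGraph public

Mult : ∀ {n} → WGraph n → Set
Mult G = Fin (m G) → ℕ

munion : ∀ {n} (G : WGraph n) → Mult G → Mult G → Mult G
munion G F F' e = F e ℕ.+ F' e

sumℕ : ∀ {k} → (Fin k → ℕ) → ℕ
sumℕ {zero}  f = 0
sumℕ {suc k} f = f zero ℕ.+ sumℕ (λ i → f (suc i))

sumℚ : ∀ {k} → (Fin k → ℚ) → ℚ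
sumℚ {zero}  f = 0ℚ
sumℚ {suc k} f = f zero ℚ.+ sumℚ (λ i → f (suc i))

len : ∀ {n} (G : WGraph n) → Mult G → ℚ
len G F = sumℚ (λ e → ((Data.Integer.+ F e) ℚ./ 1) ℚ.* ℓ G e)

-- number of endpoints of e equal to v (0 or 1, since G is loopless)
inc : ∀ {n} (G : WGraph n) → Fin (m G) → Fin n → ℕ
inc G e v = (if does (proj₁ (ends G e) ≟ v) then 1 else 0)
      ℕ.+ (if does (proj₂ (ends G e) ≟ v) then 1 else 0)

deg : ∀ {n} (G : WGraph n) → Mult G → Fin n → ℕ
deg G F v = sumℕ (λ e → F e ℕ.* inc G e v)

OddV : ∀ {n} (G : WGraph n) → Mult G → Fin n → Set
OddV G F v = deg G F v % 2 ≡ 1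

IsTJoin : ∀ {n} (G : WGraph n) → Subset n → Mult G → Set
IsTJoin G T F = ∀ v → (OddV G F v ⇔ v ∈ T)

AllEven : ∀ {n} (G : WGraph n) → Mult G → Set
AllEven G F = ∀ v → ¬ OddV G F v

-- Reachability in (V,F)/I: walks along edges of positive multiplicity in F,
-- where additionally any two vertices of I are identified (contraction of I).
data ReachC {n} (G : WGraph n) (F : Mult G) (I : Subset n) : Fin n → Fin n → Set where
  here : ∀ {u} → ReachC G F I u u
  step : ∀ {u w v} e → 0 ℕ.< F e → Joins G e u w → ReachC G F I w v → ReachC G F I u v
  jump : ∀ {u w v} → u ∈ I → w ∈ I → ReachC G F I w v → ReachC G F I u v

emptySet : ∀ {n} → Subset n
emptySet {zero}  = Data.Vec.[]
  where import Data.Vec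
emptySet {suc n} = Data.Bool.false Data.Vec.∷ emptySet
  where import Data.Vec; import Data.Bool

Reach : ∀ {n} (G : WGraph n) → Mult G → Fin n → Fin n → Set
Reach G F = ReachC G F emptySet

allE : ∀ {n} (G : WGraph n) → Mult G
allE G e = 1

InComp : ∀ {n} (G : WGraph n) → Fin n → Fin n → Set
InComp G c v = Reach G (allE G) c v

record Interface (n : ℕ) : Set where
  field
    I T      : Subset n
    k        : ℕ
    cls      : Fin k → Subset n
    T⊆I      : T ⊆ I
    Teven    : ∣ T ∣ % 2 ≡ 0
    clsNonempty : ∀ j → Nonempty (cls j)
    cls⊆I    : ∀ j → cls j ⊆ I
    covers   : ∀ {v} → v ∈ I → ∃ λ j → v ∈ cls j
    disjoint : ∀ j j' v → v ∈ cls j → v ∈ cls j' → j ≡ j'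

open Interface public

IsΦTour : ∀ {n} (G : WGraph n) → Interface n → Mult G → Set
IsΦTour G Φ F =
  IsTJoin G (T Φ) F
  × (∀ u v → ReachC G F (I Φ) u v)
  × (∀ j u v → u ∈ cls Φ j → v ∈ cls Φ j → Reach G F u v)

-- TSP tours of the connected component K of G containing c, i.e. TSP tours
-- of the (connected) induced subgraph G[K], viewed as multi-sets of edges of G.

IsCompTour : ∀ {n} (G : WGraph n) → Fin n → Mult G → Set
IsCompTour G c R =
  (∀ e → 0 ℕ.< R e → InComp G c (proj₁ (ends G e)) × InComp G c (proj₂ (ends G e)))
  × AllEven G R
  × (∀ u v → InComp G c u → InComp G c v → Reach G R u v)

IsApproxCompTour : ∀ {n} (G : WGraph n) → ℚ → Fin n → Mult G → Set
IsApproxCompTour G α c R =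
  IsCompTour G c R × (∀ R' → IsCompTour G c R' → len G R ℚ.≤ α ℚ.* len G R')

IsRestriction : ∀ {n} (G : WGraph n) → Fin n → Mult G → Mult G → Set
IsRestriction G c Q R =
  ∀ e → (InComp G c (proj₁ (ends G e)) → R e ≡ Q e)
      × (¬ InComp G c (proj₁ (ends G e)) → R e ≡ 0)

-- Q is a possible result of running an α-approximation algorithm for TSP in
-- each connected component of G and taking the multi-union of the tours.
IsComponentwiseApproxTour : ∀ {n} (G : WGraph n) → ℚ → Mult G → Set
IsComponentwiseApproxTour G α Q =
  ∀ c R → IsRestriction G c Q R → IsApproxCompTour G α c R

{-# OPTIONS --safe #-}
module Submission where

-- Every vertex v sees in Q only the tour of its own component, so deg_Q(v) is even; hence
-- odd(Q ∪ J) = odd(J) = T.  Every edge uv of G lies in a component whose tour in Q connects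
-- u and v, so Q ∪ J connects everything that any multi-set of edges connects, and the
-- connectivity conditions of a Φ-tour carry over from any Φ-tour to Q ∪ J.

open import Defs
open import Data.Nat using (ℕ; zero; suc; _+_; _*_; _<_; _%_; s≤s; z<s)
open import Data.Rational using (ℚ)
open import Data.Product using (∃; _×_; _,_; proj₁; proj₂)
open import Function.Bundles using (_⇔_; mk⇔; Equivalence)

open import Data.Nat.Properties
  using (+-0-commutativeMonoid; _<?_; >⇒≢; m≤m+n; ≤-trans; *-zeroʳ; *-distribʳ-+)
open import Algebra.Properties.CommutativeMonoid.Sum +-0-commutativeMonoid
  using (sum; sum-cong-≗; ∑-distrib-+)
open import Data.Fin using (Fin; zero; suc)
open import Data.Fin.Properties using (_≟_)
open import Data.Fin.Subset using (_∉_; ⊥; outside)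
open import Data.Fin.Subset.Properties using (∉⊥)
open import Data.Nat.Divisibility using (m%n≡0⇒n∣m)
open import Data.Nat.DivMod using (m%n<n; %-remove-+ˡ)
open import Data.Sum using (_⊎_; inj₁; inj₂; [_,_]′)
import Data.Sum as Sum
open import Data.Vec using (_∷_)
open import Function using (_∘_)
open import Level using (0ℓ)
open import Relation.Binary.Core using (Rel)
open import Relation.Binary.Construct.Closure.ReflexiveTransitive using (Star; ε; _◅_; _◅◅_)
import Relation.Binary.Construct.Closure.ReflexiveTransitive as Star
open import Relation.Binary.PropositionalEquality
  using (_≡_; _≢_; refl; sym; trans; cong; cong₂; subst; module ≡-Reasoning)
open import Relation.Nullary using (Dec; yes; no; contradiction)
open import Relation.Nullary.Decidable using (map′; _×-dec_; _⊎-dec_)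

∉emptySet : ∀ {n} {x : Fin n} → x ∉ emptySet
∉emptySet {x = x} = subst (x ∉_) (sym emptySet≡⊥) ∉⊥
  where
  emptySet≡⊥ : ∀ {n} → emptySet {n} ≡ ⊥
  emptySet≡⊥ {zero}  = refl
  emptySet≡⊥ {suc n} = cong (outside ∷_) emptySet≡⊥

sumℕ≡sum : ∀ {k} (f : Fin k → ℕ) → sumℕ f ≡ sum f
sumℕ≡sum {zero}  f = refl
sumℕ≡sum {suc k} f = cong (f zero +_) (sumℕ≡sum (f ∘ suc))

[m+n]%2≡n%2 : ∀ m n → m % 2 ≢ 1 → (m + n) % 2 ≡ n % 2
[m+n]%2≡n%2 m n m%2≢1 = %-remove-+ˡ n (m%n≡0⇒n∣m m 2 m%2≡0)
  where
  m%2≡0 : m % 2 ≡ 0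
  m%2≡0 with m % 2 | m%n<n m 2
  ... | 0           | _            = refl
  ... | 1           | _            = contradiction refl m%2≢1
  ... | suc (suc _) | s≤s (s≤s ())

-- Restricting Q to a component needs reachability to be decidable.  Walks are taken over an
-- arbitrary edge list rather than a WGraph so that it can be decided by induction on the
-- number of edges: a walk using the first edge can be shortcut to use it only once,
-- between walks that avoid it.

module _ {n : ℕ} where

  EdgeStep : ∀ {k} → (Fin k → Fin n × Fin n) → (Fin k → ℕ) → Rel (Fin n) 0ℓ
  EdgeStep ends F u w = ∃ λ e → 0 < F e × (ends e ≡ (u , w) ⊎ ends e ≡ (w , u))

  Walk : ∀ {k} → (Fin k → Fin n × Fin n) → (Fin k → ℕ) → Rel (Fin n) 0ℓ
  Walk ends F = Star (EdgeStep ends F)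

  module FirstEdge {k : ℕ} (ends : Fin (suc k) → Fin n × Fin n) (F : Fin (suc k) → ℕ) where

    a b : Fin n
    a = proj₁ (ends zero)
    b = proj₂ (ends zero)

    Walk′ : Rel (Fin n) 0ℓ
    Walk′ = Walk (ends ∘ suc) (F ∘ suc)

    private
      weaken : ∀ {u v} → Walk′ u v → Walk ends F u v
      weaken = Star.map λ (e , F>0 , j) → suc e , F>0 , j

    ViaFirstEdge : Rel (Fin n) 0ℓ
    ViaFirstEdge u v = 0 < F zero × (Walk′ u a ⊎ Walk′ u b) × (Walk′ a v ⊎ Walk′ b v)

    walk⇔ : ∀ {u v} → Walk ends F u v ⇔ (Walk′ u v ⊎ ViaFirstEdge u v)
    walk⇔ = mk⇔ shortcut expand
      where
      shortcut : ∀ {u v} → Walk ends F u v → Walk′ u v ⊎ ViaFirstEdge u v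
      shortcut ε = inj₁ ε
      shortcut ((suc e , F>0 , j) ◅ w) with shortcut w
      ... | inj₁ w′ = inj₁ ((e , F>0 , j) ◅ w′)
      ... | inj₂ (F₀>0 , into , out) =
        inj₂ (F₀>0 , Sum.map ((e , F>0 , j) ◅_) ((e , F>0 , j) ◅_) into , out)
      shortcut ((zero , F₀>0 , inj₁ refl) ◅ w) =
        inj₂ (F₀>0 , inj₁ ε , [ inj₂ , proj₂ ∘ proj₂ ]′ (shortcut w))
      shortcut ((zero , F₀>0 , inj₂ refl) ◅ w) =
        inj₂ (F₀>0 , inj₂ ε , [ inj₁ , proj₂ ∘ proj₂ ]′ (shortcut w))

      expand : ∀ {u v} → Walk′ u v ⊎ ViaFirstEdge u v → Walk ends F u v
      expand (inj₁ w) = weaken w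
      expand (inj₂ (F₀>0 , into , out)) = enter into ◅◅ leave out
        where
        enter : ∀ {u} → Walk′ u a ⊎ Walk′ u b → Walk ends F u a
        enter (inj₁ w) = weaken w
        enter (inj₂ w) = weaken w ◅◅ (zero , F₀>0 , inj₂ refl) ◅ ε
        leave : ∀ {v} → Walk′ a v ⊎ Walk′ b v → Walk ends F a v
        leave (inj₁ w) = weaken w
        leave (inj₂ w) = (zero , F₀>0 , inj₁ refl) ◅ weaken w

  walk? : ∀ {k} (ends : Fin k → Fin n × Fin n) (F : Fin k → ℕ) u v → Dec (Walk ends F u v)
  walk? {zero} ends F u v = map′ (λ { refl → ε }) (λ { ε → refl ; ((() , _) ◅ _) }) (u ≟ v)
  walk? {suc k} ends F u v =
    map′ (Equivalence.from walk⇔) (Equivalence.to walk⇔)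
      (walk?′ u v ⊎-dec
        (0 <? F zero ×-dec ((walk?′ u a ⊎-dec walk?′ u b) ×-dec (walk?′ a v ⊎-dec walk?′ b v))))
    where
    open FirstEdge ends F
    walk?′ : ∀ u v → Dec (Walk′ u v)
    walk?′ = walk? (ends ∘ suc) (F ∘ suc)

module _ {n : ℕ} (G : WGraph n) where

  Reach⇔Walk : ∀ {F u v} → Reach G F u v ⇔ Walk (ends G) F u v
  Reach⇔Walk = mk⇔ toWalk fromWalk
    where
    toWalk : ∀ {F u v} → Reach G F u v → Walk (ends G) F u v
    toWalk here             = ε
    toWalk (step e F>0 j r) = (e , F>0 , j) ◅ toWalk r
    toWalk (jump u∈∅ _ _)   = contradiction u∈∅ ∉emptySet
    fromWalk : ∀ {F u v} → Walk (ends G) F u v → Reach G F u v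
    fromWalk ε                   = here
    fromWalk ((e , F>0 , j) ◅ w) = step e F>0 j (fromWalk w)

  reach? : ∀ F u v → Dec (Reach G F u v)
  reach? F u v =
    map′ (Equivalence.from Reach⇔Walk) (Equivalence.to Reach⇔Walk) (walk? (ends G) F u v)

  ReachC-trans : ∀ {F I u w v} → ReachC G F I u w → ReachC G F I w v → ReachC G F I u v
  ReachC-trans here              s = s
  ReachC-trans (step e F>0 j r)  s = step e F>0 j (ReachC-trans r s)
  ReachC-trans (jump u∈I w∈I r) s = jump u∈I w∈I (ReachC-trans r s)

  Reach⇒ReachC : ∀ {F I u v} → Reach G F u v → ReachC G F I u v
  Reach⇒ReachC here             = here
  Reach⇒ReachC (step e F>0 j r) = step e F>0 j (Reach⇒ReachC r)
  Reach⇒ReachC (jump u∈∅ _ _)  = contradiction u∈∅ ∉emptySet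

  ReachC-mono : ∀ {F F′ I u v} →
                (∀ e → 0 < F e → 0 < F′ e) → ReachC G F I u v → ReachC G F′ I u v
  ReachC-mono F⊆F′ here              = here
  ReachC-mono F⊆F′ (step e F>0 j r)  = step e (F⊆F′ e F>0) j (ReachC-mono F⊆F′ r)
  ReachC-mono F⊆F′ (jump u∈I w∈I r) = jump u∈I w∈I (ReachC-mono F⊆F′ r)

  ConnectsAllEdges : Mult G → Set
  ConnectsAllEdges H = ∀ e {u w} → Joins G e u w → Reach G H u w

  ReachC-reroute : ∀ {F H I u v} → ConnectsAllEdges H → ReachC G F I u v → ReachC G H I u v
  ReachC-reroute connects here              = here
  ReachC-reroute connects (step e _ j r)    =
    ReachC-trans (Reach⇒ReachC (connects e j)) (ReachC-reroute connects r)
  ReachC-reroute connects (jump u∈I w∈I r) = jump u∈I w∈I (ReachC-reroute connects r)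

  IsΦTour-reroute : ∀ {Φ F H} →
                    ConnectsAllEdges H → IsTJoin G (T Φ) H → IsΦTour G Φ F → IsΦTour G Φ H
  IsΦTour-reroute connects H-join (_ , connected , classes) =
    H-join , (λ u v → ReachC-reroute connects (connected u v))
           , (λ j u v u∈C v∈C → ReachC-reroute connects (classes j u v u∈C v∈C))

  restrictToComp : Mult G → Fin n → Mult G
  restrictToComp Q c e with reach? (allE G) c (proj₁ (ends G e))
  ... | yes _ = Q e
  ... | no _  = 0

  restrictToComp-isRestriction : ∀ Q c → IsRestriction G c Q (restrictToComp Q c)
  restrictToComp-isRestriction Q c e with reach? (allE G) c (proj₁ (ends G e))
  ... | yes inK = (λ _ → refl) , (λ ∉K → contradiction inK ∉K)
  ... | no ∉K   = (λ inK → contradiction inK ∉K) , (λ _ → refl)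

  restriction-pos : ∀ {c Q R} → IsRestriction G c Q R → ∀ e → 0 < R e → 0 < Q e
  restriction-pos {c} R-restr e R>0 with reach? (allE G) c (proj₁ (ends G e))
  ... | yes inK = subst (0 <_) (proj₁ (R-restr e) inK) R>0
  ... | no ∉K   = contradiction (proj₂ (R-restr e) ∉K) (>⇒≢ R>0)

  inc≡0⊎InComp : ∀ e v → inc G e v ≡ 0 ⊎ InComp G v (proj₁ (ends G e))
  inc≡0⊎InComp e v with proj₁ (ends G e) ≟ v | proj₂ (ends G e) ≟ v
  ... | yes refl | _        = inj₂ here
  ... | no _     | yes refl = inj₂ (step e z<s (inj₂ refl) here)
  ... | no _     | no _     = inj₁ refl

  deg≡sum : ∀ F v → deg G F v ≡ sum (λ e → F e * inc G e v)
  deg≡sum F v = sumℕ≡sum (λ e → F e * inc G e v)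

  restriction-deg : ∀ {v Q R} → IsRestriction G v Q R → deg G R v ≡ deg G Q v
  restriction-deg {v} {Q} {R} R-restr = begin
    deg G R v                    ≡⟨ deg≡sum R v ⟩
    sum (λ e → R e * inc G e v)  ≡⟨ sum-cong-≗ agree ⟩
    sum (λ e → Q e * inc G e v)  ≡⟨ deg≡sum Q v ⟨
    deg G Q v                    ∎
    where
    open ≡-Reasoning
    agree : ∀ e → R e * inc G e v ≡ Q e * inc G e v
    agree e with inc≡0⊎InComp e v
    ... | inj₁ inc≡0 rewrite inc≡0 | *-zeroʳ (R e) | *-zeroʳ (Q e) = refl
    ... | inj₂ inK = cong (_* inc G e v) (proj₁ (R-restr e) inK)

  deg-munion : ∀ F F′ v → deg G (munion G F F′) v ≡ deg G F v + deg G F′ v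
  deg-munion F F′ v = begin
    deg G (munion G F F′) v                         ≡⟨ deg≡sum (munion G F F′) v ⟩
    sum (λ e → (F e + F′ e) * inc G e v)            ≡⟨ sum-cong-≗ (λ e → *-distribʳ-+ (inc G e v) (F e) (F′ e)) ⟩
    sum (λ e → F e * inc G e v + F′ e * inc G e v)  ≡⟨ ∑-distrib-+ (λ e → F e * inc G e v) (λ e → F′ e * inc G e v) ⟩
    sum (λ e → F e * inc G e v) + sum (λ e → F′ e * inc G e v)
                                                    ≡⟨ cong₂ _+_ (deg≡sum F v) (deg≡sum F′ v) ⟨
    deg G F v + deg G F′ v                          ∎
    where open ≡-Reasoning

  allEven-munion-isTJoin : ∀ {T Q J} → AllEven G Q → IsTJoin G T J → IsTJoin G T (munion G Q J)
  allEven-munion-isTJoin {Q = Q} {J} Q-even J-join v =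
    mk⇔ (to ∘ trans (sym same-parity)) (trans same-parity ∘ from)
    where
    open Equivalence (J-join v)
    same-parity : deg G (munion G Q J) v % 2 ≡ deg G J v % 2
    same-parity = trans (cong (_% 2) (deg-munion Q J v)) ([m+n]%2≡n%2 (deg G Q v) (deg G J v) (Q-even v))

  IsComponentwiseTour : Mult G → Set
  IsComponentwiseTour Q = ∀ c R → IsRestriction G c Q R → IsCompTour G c R

  module _ {Q : Mult G} (Q-tour : IsComponentwiseTour Q) where

    private
      tourOfComp : ∀ c → IsCompTour G c (restrictToComp Q c)
      tourOfComp c = Q-tour c (restrictToComp Q c) (restrictToComp-isRestriction Q c)

    componentwiseTour-allEven : AllEven G Q
    componentwiseTour-allEven v Q-odd = proj₁ (proj₂ (tourOfComp v)) v
      (subst (λ d → d % 2 ≡ 1) (sym (restriction-deg (restrictToComp-isRestriction Q v))) Q-odd)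

    componentwiseTour-connectsAllEdges : ConnectsAllEdges Q
    componentwiseTour-connectsAllEdges e {u} {w} j =
      ReachC-mono (restriction-pos (restrictToComp-isRestriction Q u))
        (proj₂ (proj₂ (tourOfComp u)) u w here (step e z<s j here))

lemma4p1 : ∀ {n} (G : WGraph n) (α : ℚ) (Φ : Interface n) (J : Mult G)
    → IsTJoin G (T Φ) J
    → (Q : Mult G) → IsComponentwiseApproxTour G α Q
    → (IsΦTour G Φ (munion G Q J) ⇔ ∃ λ F → IsΦTour G Φ F)
lemma4p1 G α Φ J J-join Q Q-approx =
  mk⇔ (λ H-tour → munion G Q J , H-tour)
      (λ (F , F-tour) → IsΦTour-reroute G {Φ} {F} H-connects H-join F-tour)
  where
  Q-tour : IsComponentwiseTour G Q
  Q-tour c R R-restr = proj₁ (Q-approx c R R-restr)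
  H-join : IsTJoin G (T Φ) (munion G Q J)
  H-join = allEven-munion-isTJoin G {Q = Q} {J} (componentwiseTour-allEven G Q-tour) J-join
  H-connects : ConnectsAllEdges G (munion G Q J)
  H-connects e j = ReachC-mono G (λ e Q>0 → ≤-trans Q>0 (m≤m+n (Q e) (J e)))
                                 (componentwiseTour-connectsAllEdges G Q-tour e j)
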